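{- Let $A$ be a partial $\delta$-ring of degree $s$ over $R_{\pi}$ (with higher $\pi$-derivations $\delta_1^{(s)},\ldots,\delta_n^{(s)}$ compatible with the fixed ones on $R_\pi$ and associated higher $\pi$-Frobenius lifts $\phi_1^{(s)},\ldots,\phi_n^{(s)}$), and assume $A$ is flat over $R_{\pi}$. Then for all $a\in A$ and all $i,j\in\{1,\ldots,n\}$ we have the following congruences in $A$: $$\phi^{(s)}_{i}\phi^{(s)}_{j} a-\phi^{(s)}_{j}\phi^{(s)}_{i} a \equiv 0 \ \ \mathrm{mod}\ \pi,$$ $$\delta_{ij}^{(2s)}a \equiv \delta^{(s)}_{i} \pi\cdot (\delta^{(s)}_{j}a)^{p^s}\ \ \mathrm{mod}\ \pi,$$ $$\frac{1}{\pi}(\phi^{(s)}_{i}\phi^{(s)}_{j} a-\phi^{(s)}_{j}\phi^{(s)}_{i} a) \equiv \delta^{(s)}_{i}\pi \cdot (\delta^{(s)}_{j} a)^{p^s}- \delta^{(s)}_{j}\pi \cdot (\delta^{(s)}_{i} a)^{p^s} \equiv \delta_{ij}^{(2s)}a-\delta^{(2s)}_{ji}a\ \ \mathrm{mod}\ \pi.$$ If in addition $\phi^{(s)}_{i} a\equiv \phi^{(s)}_{j} a$ mod $\pi^2$ for all $a\in R_{\pi}$, then $\delta^{(s)}_i a\equiv \delta^{(s)}_j a$ mod $\pi$ for all $a\in R_{\pi}$.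
   Context: $p$ is a fixed odd prime. $R$ is the $p$-adic completion of the ring of integers of the maximal unramified extension of $\mathbb Q_p$, $K=R[1/p]$. $\Pi$ is the set of elements $\pi$ of $\mathbb Q_p^{\mathrm{alg}}$ which are prime elements of some finite Galois extension of $\mathbb Q_p$; fix $\pi\in\Pi$, set $K_\pi=K(\pi)$ and $R_\pi=R[\pi]$ (the valuation ring of $K_\pi$, with uniformizer $\pi$). Fix $s\ge 1$ and $n\ge1$. For an $R_\pi$-algebra $A$: a higher $\pi$-Frobenius lift of degree $s$ on $A$ is a ring endomorphism $\phi$ of $A$ with $\phi(a)\equiv a^{p^s}$ mod $\pi A$ for all $a$; a higher $\pi$-derivation of degree $s$ on $A$ is a map $\delta:A\to A$ with $\delta(1)=0$, $\delta(x+y)=\delta x+\delta y+\frac{p}{\pi}C_p^{(s)}(x,y)$ and $\delta(xy)=x^{p^s}\delta y+y^{p^s}\delta x+\pi\,\delta x\,\delta y$, where $C_p^{(s)}(X,Y)=(X^{p^s}+Y^{p^s}-(X+Y)^{p^s})/p$; its associated higher $\pi$-Frobenius lift is $\phi(x)=x^{p^s}+\pi\delta x$. Fix an $n$-tuple $(\delta_1^{(s)},\ldots,\delta_n^{(s)})$ of higher $\pi$-derivations of degree $s$ on $R_\pi$. A partial $\delta$-ring of degree $s$ is an $R_\pi$-algebra with an $n$-tuple of higher $\pi$-derivations of degree $s$ extending the fixed ones on $R_\pi$. For $A$ flat over $R_\pi$, $\delta^{(2s)}_{ij}$ denotes the higher $\pi$-derivation of degree $2s$ associated to the lift $\phi_i^{(s)}\circ\phi_j^{(s)}$,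 i.e. $\delta^{(2s)}_{ij}(a)=(\phi^{(s)}_i\phi^{(s)}_j(a)-a^{p^{2s}})/\pi$. -}

module Defs where

open import Level using (Level; _⊔_)
open import Data.Nat as ℕ using (ℕ; zero; suc; _∸_; _/_)
open import Data.Nat.Combinatorics using (_C_)
open import Data.Product using (∃; Σ; _×_; _,_)
open import Data.Sum using (_⊎_)
open import Data.Fin using (Fin)
open import Relation.Nullary using (¬_)
open import Algebra.Bundles using (CommutativeRing; RawRing)
open import Algebra.Morphism.Structures using (IsRingHomomorphism)
import Algebra.Definitions.RawSemiring as RS

private variable c ℓ c' ℓ' : Level

-- natural-number power (to avoid clashing with the ring power)
_^ℕ_ : ℕ → ℕ → ℕ
_^ℕ_ = ℕ._^_

-- exact division by p (used only for p prime, where it is exact on the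
-- binomial coefficients occurring below)
divBy : ℕ → ℕ → ℕ
divBy zero    m = 0
divBy (suc q) m = m / suc q

module RingOps (B : CommutativeRing c ℓ) where
  open CommutativeRing B
  open RS (RawRing.rawSemiring rawRing) public using (_^_) renaming (_×_ to _·ℕ_)

  sumFrom1 : (ℕ → Carrier) → ℕ → Carrier
  sumFrom1 f zero    = 0#
  sumFrom1 f (suc m) = sumFrom1 f m + f (suc m)

  -- C_p^{(s)}(X,Y) = (X^{p^s} + Y^{p^s} - (X+Y)^{p^s}) / p
  --               = - Σ_{k=1}^{p^s - 1} (binom(p^s,k)/p) X^k Y^{p^s-k}
  Cps : ℕ → ℕ → Carrier → Carrier → Carrier
  Cps p s x y =
    - sumFrom1 (λ k → divBy p ((p ^ℕ s) C k) ·ℕ (x ^ k * y ^ ((p ^ℕ s) ∸ k)))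
               ((p ^ℕ s) ∸ 1)

  Cong : Carrier → Carrier → Carrier → Set (c ⊔ ℓ)
  Cong m x y = ∃ λ z → (x - y) ≈ m * z

  -- higher π-derivation of degree s on B, where ϖ is the image of π
  -- and ν the image of p/π
  record IsHigherDeriv (p s : ℕ) (ϖ ν : Carrier) (δ : Carrier → Carrier)
         : Set (c ⊔ ℓ) where
    field
      δ-cong : ∀ {x y} → x ≈ y → δ x ≈ δ y
      δ-one  : δ 1# ≈ 0#
      δ-add  : ∀ x y → δ (x + y) ≈ (δ x + δ y) + ν * Cps p s x y
      δ-mul  : ∀ x y → δ (x * y) ≈
                 (x ^ (p ^ℕ s) * δ y + y ^ (p ^ℕ s) * δ x) + ϖ * δ x * δ y

  frob : (p s : ℕ) (ϖ : Carrier) (δ : Carrier → Carrier) → Carrier → Carrier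
  frob p s ϖ δ x = x ^ (p ^ℕ s) + ϖ * δ x

record PiBase (p : ℕ) (c ℓ : Level) : Set (Level.suc (c ⊔ ℓ)) where
  field
    Rπ : CommutativeRing c ℓ
  open CommutativeRing Rπ public
  open RingOps Rπ public
  field
    π          : Carrier
    p/π        : Carrier
    π*p/π≈p    : π * p/π ≈ p ·ℕ 1#
    1≉0        : ¬ (1# ≈ 0#)
    domain     : ∀ x y → x * y ≈ 0# → (x ≈ 0#) ⊎ (y ≈ 0#)
    π≉0        : ¬ (π ≈ 0#)
    π-nonunit  : ¬ (∃ λ v → π * v ≈ 1#)

record PartialDeltaRing {p : ℕ} (s n : ℕ) (B : PiBase p c ℓ)
       (δR : Fin n → PiBase.Carrier B → PiBase.Carrier B) (c' ℓ' : Level)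
       : Set (c ⊔ ℓ ⊔ Level.suc (c' ⊔ ℓ')) where
  module R = PiBase B
  field
    A     : CommutativeRing c' ℓ'
  open CommutativeRing A public
  open RingOps A public
  field
    ι     : R.Carrier → Carrier
    ι-hom : IsRingHomomorphism R.rawRing rawRing ι
    δ     : Fin n → Carrier → Carrier
    δ-der : ∀ i → IsHigherDeriv p s (ι R.π) (ι R.p/π) (δ i)
    δ-ext : ∀ i r → δ i (ι r) ≈ ι (δR i r)

  -- flatness over the DVR R_π, i.e. π-torsion-freeness
  Flat : Set (c' ⊔ ℓ')
  Flat = ∀ x → ι R.π * x ≈ 0# → x ≈ 0#

  φ : Fin n → Carrier → Carrier
  φ i = frob p s (ι R.π) (δ i)

  -- d is δ^{(2s)}_{ij} a, i.e.  π d = φ_i φ_j a - a^{p^{2s}}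
  IsDelta2 : Fin n → Fin n → Carrier → Carrier → Set ℓ'
  IsDelta2 i j a d = ι R.π * d ≈ φ i (φ j a) - a ^ (p ^ℕ (s ℕ.+ s))

-- Write q = p^s and ϖ for the image of π.  As p = π · (p/π) and s ≥ 1, ϖ divides q, so the
-- binomial expansion gives (x + ϖ y)^q ≡ x^q mod ϖ²; and every monomial of C_p^{(s)}(x, ϖ w)
-- contains ϖ.  From the axioms of a higher π-derivation δ with lift φ this yields
-- ϖ δ(a^q) ≡ 0 mod ϖ² (compare φ(a^q) with φ(a)^q) and δ(x + ϖ w) ≡ δ x + (δ ϖ) w^q mod ϖ, hence
--   φ_i φ_j a = φ_i (a^q + ϖ δ_j a) ≡ a^{q²} + ϖ (δ_i ϖ) (δ_j a)^q  mod ϖ².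
-- Every congruence of the theorem follows from this expansion by cancelling one factor ϖ,
-- legitimate because A is ϖ-torsion-free; the last claim is the same cancellation in the
-- domain R_π.

module Submission where

open import Defs
open import Level using (Level; _⊔_)
open import Data.Nat as ℕ using (ℕ; zero; suc; _∸_; _≤_; _<_)
import Data.Nat.Properties as ℕ
open import Data.Nat.Combinatorics using (_C_)
open import Data.Nat.Primality using (Prime; prime⇒nonZero)
open import Data.Fin using (Fin)
open import Data.Product using (∃; _×_; _,_)
open import Data.Sum using (inj₁; inj₂)
open import Relation.Binary.Bundles using (Setoid)
open import Relation.Binary.PropositionalEquality using (_≢_)
open import Relation.Nullary using (contradiction)
open import Algebra using (CommutativeRing)
open import Algebra.Morphism.Structures using (IsRingHomomorphism)
import Algebra.Properties.Ring as RingProperties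
import Algebra.Properties.AbelianGroup as AbelianGroupProperties
import Algebra.Properties.Monoid.Mult as MonoidMultProperties
import Algebra.Properties.Semiring.Mult as SemiringMultProperties
import Algebra.Properties.Semiring.Exp as SemiringExpProperties
import Algebra.Properties.CommutativeSemiring.Exp as CommutativeSemiringExpProperties
import Algebra.Solver.Ring.NaturalCoefficients.Default as NaturalSolver
import Relation.Binary.Reasoning.Setoid as SetoidReasoning

module Congruence {c ℓ} (R : CommutativeRing c ℓ) where
  open CommutativeRing R
  open RingOps R
  open RingProperties ring using (-‿distribʳ-*; x[y-z]≈xy-xz)
  open AbelianGroupProperties +-abelianGroup using (⁻¹-∙-comm; ∙-cancelˡ; x∙y⁻¹≈ε⇒x≈y)
  open NaturalSolver commutativeSemiring using (solve; _:=_; _:+_; _:*_; con)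
  open SetoidReasoning setoid

  private variable m x y z u v w : Carrier

  x≈y+w⇒x-y≈w : x ≈ y + w → x - y ≈ w
  x≈y+w⇒x-y≈w {x} {y} {w} x≈y+w = begin
    x - y               ≈⟨ +-cong x≈y+w refl ⟩
    (y + w) + - y       ≈⟨ solve 3 (λ y w ny → (y :+ w) :+ ny := w :+ (y :+ ny)) refl y w (- y) ⟩
    w + (y - y)         ≈⟨ +-cong refl (-‿inverseʳ y) ⟩
    w + 0#              ≈⟨ +-identityʳ w ⟩
    w                   ∎

  x-y≈w⇒x≈y+w : x - y ≈ w → x ≈ y + w
  x-y≈w⇒x≈y+w {x} {y} {w} x-y≈w = begin
    x                   ≈⟨ +-identityʳ x ⟨
    x + 0#              ≈⟨ +-cong refl (-‿inverseˡ y) ⟨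
    x + (- y + y)       ≈⟨ solve 3 (λ x ny y → x :+ (ny :+ y) := y :+ (x :+ ny)) refl x (- y) y ⟩
    y + (x - y)         ≈⟨ +-cong refl x-y≈w ⟩
    y + w               ∎

  [x+y]-[x+z]≈y-z : ∀ x y z → (x + y) - (x + z) ≈ y - z
  [x+y]-[x+z]≈y-z x y z = begin
    (x + y) + - (x + z)      ≈⟨ +-cong refl (⁻¹-∙-comm x z) ⟨
    (x + y) + (- x + - z)    ≈⟨ solve 4 (λ x y nx nz → (x :+ y) :+ (nx :+ nz) := (x :+ nx) :+ (y :+ nz)) refl x y (- x) (- z) ⟩
    (x - x) + (y - z)        ≈⟨ +-cong (-‿inverseʳ x) refl ⟩
    0# + (y - z)             ≈⟨ +-identityˡ (y - z) ⟩
    y - z                    ∎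

  +-multiple⇒Cong : ∀ k → x ≈ y + m * k → Cong m x y
  +-multiple⇒Cong k x≈y+mk = k , x≈y+w⇒x-y≈w x≈y+mk

  Cong⇒+-multiple : Cong m x y → ∃ λ k → x ≈ y + m * k
  Cong⇒+-multiple (k , x-y≈mk) = k , x-y≈w⇒x≈y+w x-y≈mk

  ≈⇒Cong : x ≈ y → Cong m x y
  ≈⇒Cong {x} {y} {m} x≈y = +-multiple⇒Cong 0# (begin
    x              ≈⟨ x≈y ⟩
    y              ≈⟨ solve 2 (λ y m → y := y :+ m :* con 0) refl y m ⟩
    y + m * 0#     ∎)

  Cong-refl : Cong m x x
  Cong-refl = ≈⇒Cong refl

  Cong-sym : Cong m x y → Cong m y x
  Cong-sym {m} {x} {y} x≡y with Cong⇒+-multiple x≡y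
  ... | k , x≈y+mk = +-multiple⇒Cong (- k) (begin
    y                          ≈⟨ +-identityʳ y ⟨
    y + 0#                     ≈⟨ +-cong refl (zeroʳ m) ⟨
    y + m * 0#                 ≈⟨ +-cong refl (*-cong refl (-‿inverseʳ k)) ⟨
    y + m * (k - k)            ≈⟨ solve 4 (λ y m k nk → y :+ m :* (k :+ nk) := (y :+ m :* k) :+ m :* nk) refl y m k (- k) ⟩
    (y + m * k) + m * - k      ≈⟨ +-cong x≈y+mk refl ⟨
    x + m * - k                ∎)

  Cong-trans : Cong m x y → Cong m y z → Cong m x z
  Cong-trans {m} {x} {y} {z} x≡y y≡z with Cong⇒+-multiple x≡y | Cong⇒+-multiple y≡z
  ... | k , x≈y+mk | l , y≈z+ml = +-multiple⇒Cong (l + k) (begin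
    x                          ≈⟨ x≈y+mk ⟩
    y + m * k                  ≈⟨ +-cong y≈z+ml refl ⟩
    (z + m * l) + m * k        ≈⟨ solve 4 (λ z m l k → (z :+ m :* l) :+ m :* k := z :+ m :* (l :+ k)) refl z m l k ⟩
    z + m * (l + k)            ∎)

  congSetoid : Carrier → Setoid c (c ⊔ ℓ)
  congSetoid m = record
    { Carrier = Carrier
    ; _≈_ = Cong m
    ; isEquivalence = record { refl = Cong-refl ; sym = Cong-sym ; trans = Cong-trans }
    }

  Cong-+ : Cong m x y → Cong m u v → Cong m (x + u) (y + v)
  Cong-+ {m} {x} {y} {u} {v} x≡y u≡v with Cong⇒+-multiple x≡y | Cong⇒+-multiple u≡v
  ... | k , x≈y+mk | l , u≈v+ml = +-multiple⇒Cong (k + l) (begin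
    x + u                      ≈⟨ +-cong x≈y+mk u≈v+ml ⟩
    (y + m * k) + (v + m * l)  ≈⟨ solve 5 (λ y v m k l → (y :+ m :* k) :+ (v :+ m :* l) := (y :+ v) :+ m :* (k :+ l)) refl y v m k l ⟩
    (y + v) + m * (k + l)      ∎)

  Cong-neg : Cong m x y → Cong m (- x) (- y)
  Cong-neg {m} {x} {y} x≡y with Cong⇒+-multiple x≡y
  ... | k , x≈y+mk = +-multiple⇒Cong (- k) (begin
    - x                        ≈⟨ -‿cong x≈y+mk ⟩
    - (y + m * k)              ≈⟨ ⁻¹-∙-comm y (m * k) ⟨
    - y + - (m * k)            ≈⟨ +-cong refl (-‿distribʳ-* m k) ⟩
    - y + m * - k              ∎)

  Cong-* : Cong m x y → Cong m u v → Cong m (x * u) (y * v)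
  Cong-* {m} {x} {y} {u} {v} x≡y u≡v with Cong⇒+-multiple x≡y | Cong⇒+-multiple u≡v
  ... | k , x≈y+mk | l , u≈v+ml = +-multiple⇒Cong (k * v + y * l + m * k * l) (begin
    x * u                      ≈⟨ *-cong x≈y+mk u≈v+ml ⟩
    (y + m * k) * (v + m * l)  ≈⟨ solve 5 (λ y v m k l → (y :+ m :* k) :* (v :+ m :* l)
                                    := y :* v :+ m :* (k :* v :+ y :* l :+ m :* k :* l)) refl y v m k l ⟩
    y * v + m * (k * v + y * l + m * k * l) ∎)

  multiple-Cong0 : ∀ k → Cong m (m * k) 0#
  multiple-Cong0 {m} k = +-multiple⇒Cong k (sym (+-identityˡ (m * k)))

  modulus-Cong0 : Cong m m 0#
  modulus-Cong0 {m} = Cong-trans (≈⇒Cong (sym (*-identityʳ m))) (multiple-Cong0 1#)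

  Cong-weaken : ∀ k → Cong (m * k) x y → Cong m x y
  Cong-weaken {m} {x} {y} k x≡y with Cong⇒+-multiple x≡y
  ... | l , x≈y+mkl = +-multiple⇒Cong (k * l) (trans x≈y+mkl (+-cong refl (*-assoc m k l)))

  Cong-scale : ∀ w → Cong m x y → Cong (w * m) (w * x) (w * y)
  Cong-scale {m} {x} {y} w x≡y with Cong⇒+-multiple x≡y
  ... | k , x≈y+mk = +-multiple⇒Cong k (begin
    w * x                      ≈⟨ *-cong refl x≈y+mk ⟩
    w * (y + m * k)            ≈⟨ solve 4 (λ w y m k → w :* (y :+ m :* k) := w :* y :+ w :* m :* k) refl w y m k ⟩
    w * y + w * m * k          ∎)

  Cong-+-cancelˡ : ∀ w → Cong m (w + x) (w + y) → Cong m x y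
  Cong-+-cancelˡ {m} {x} {y} w w+x≡w+y with Cong⇒+-multiple w+x≡w+y
  ... | k , w+x≈w+y+mk = +-multiple⇒Cong k (∙-cancelˡ w x (y + m * k) (trans w+x≈w+y+mk (+-assoc w y (m * k))))

  *-cancelˡ-torsionFree : (∀ x → w * x ≈ 0# → x ≈ 0#) → w * x ≈ w * y → x ≈ y
  *-cancelˡ-torsionFree {w} {x} {y} torsionFree wx≈wy =
    x∙y⁻¹≈ε⇒x≈y x y (torsionFree (x - y) (trans (x[y-z]≈xy-xz w x y) (trans (+-cong wx≈wy refl) (-‿inverseʳ (w * y)))))

  Cong-*-cancelˡ : (∀ x → w * x ≈ 0# → x ≈ 0#) → Cong (w * m) (w * x) (w * y) → Cong m x y
  Cong-*-cancelˡ {w} {m} {x} {y} torsionFree wx≡wy with Cong⇒+-multiple wx≡wy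
  ... | k , wx≈wy+wmk = +-multiple⇒Cong k (*-cancelˡ-torsionFree torsionFree (begin
    w * x                      ≈⟨ wx≈wy+wmk ⟩
    w * y + w * m * k          ≈⟨ solve 4 (λ w y m k → w :* y :+ w :* m :* k := w :* (y :+ m :* k)) refl w y m k ⟩
    w * (y + m * k)            ∎))

  module CongReasoning (m : Carrier) = SetoidReasoning (congSetoid m)

module Perturbation {c ℓ} (R : CommutativeRing c ℓ) where
  open CommutativeRing R
  open RingOps R
  open Congruence R
  open AbelianGroupProperties +-abelianGroup using (ε⁻¹≈ε)
  open SemiringMultProperties semiring using (×-assoc-*; ×-comm-*)
  open MonoidMultProperties +-monoid using (×-congʳ)
  open NaturalSolver commutativeSemiring using (solve; _:=_; _:+_; _:*_; con)

  private variable m x u : Carrier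

  Cong0-+ : Cong m x 0# → Cong m u 0# → Cong m (x + u) 0#
  Cong0-+ x≡0 u≡0 = Cong-trans (Cong-+ x≡0 u≡0) (≈⇒Cong (+-identityʳ 0#))

  Cong0-*ˡ : ∀ y → Cong m x 0# → Cong m (y * x) 0#
  Cong0-*ˡ y x≡0 = Cong-trans (Cong-* Cong-refl x≡0) (≈⇒Cong (zeroʳ y))

  Cong0-*ʳ : ∀ y → Cong m x 0# → Cong m (x * y) 0#
  Cong0-*ʳ y x≡0 = Cong-trans (Cong-* x≡0 Cong-refl) (≈⇒Cong (zeroˡ y))

  Cong0-× : ∀ n → Cong m u 0# → Cong m (n ·ℕ u) 0#
  Cong0-× zero    u≡0 = Cong-refl
  Cong0-× (suc n) u≡0 = Cong0-+ u≡0 (Cong0-× n u≡0)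

  ×1-Cong0 : ∀ n → Cong m (n ·ℕ 1#) 0# → ∀ u → Cong m (n ·ℕ u) 0#
  ×1-Cong0 {m} n n·1≡0 u = begin
    n ·ℕ u          ≈⟨ ≈⇒Cong (trans (×-assoc-* n 1# u) (×-congʳ n (*-identityˡ u))) ⟨
    (n ·ℕ 1#) * u   ≈⟨ Cong-* n·1≡0 Cong-refl ⟩
    0# * u          ≈⟨ ≈⇒Cong (zeroˡ u) ⟩
    0#              ∎
    where open CongReasoning m

  Cong0-^ : ∀ {n} → 1 ≤ n → Cong m x 0# → Cong m (x ^ n) 0#
  Cong0-^ {x = x} {n = suc n} _ x≡0 = Cong-trans (Cong-* x≡0 Cong-refl) (≈⇒Cong (zeroˡ (x ^ n)))

  ^-+-multiple : ∀ n m x y → Cong (m * m) ((x + m * y) ^ suc n) (x ^ suc n + m * (suc n ·ℕ (x ^ n * y)))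
  ^-+-multiple zero    m x y = ≈⇒Cong (solve 3 (λ x y m → (x :+ m :* y) :* con 1 := x :* con 1 :+ m :* (con 1 :* y :+ con 0)) refl x y m)
  ^-+-multiple (suc n) m x y = begin
    (x + m * y) * (x + m * y) ^ suc n          ≈⟨ Cong-* Cong-refl (^-+-multiple n m x y) ⟩
    (x + m * y) * (X + m * N)                  ≈⟨ ≈⇒Cong (solve 5 (λ x y m X N → (x :+ m :* y) :* (X :+ m :* N)
                                                   := (x :* X :+ m :* (y :* X :+ x :* N)) :+ m :* m :* (y :* N)) refl x y m X N) ⟩
    (x * X + m * (y * X + x * N)) + m * m * (y * N)  ≈⟨ Cong-+ Cong-refl (multiple-Cong0 (y * N)) ⟩
    (x * X + m * (y * X + x * N)) + 0#          ≈⟨ ≈⇒Cong (trans (+-identityʳ _) (+-cong refl (*-cong refl (+-cong (*-comm y X) xN≈[n+1]·Xy)))) ⟩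
    x * X + m * (suc (suc n) ·ℕ (X * y))        ∎
    where
    open CongReasoning (m * m)
    X = x ^ suc n
    N = suc n ·ℕ (x ^ n * y)
    xN≈[n+1]·Xy : x * N ≈ suc n ·ℕ (X * y)
    xN≈[n+1]·Xy = trans (×-comm-* (suc n) x (x ^ n * y)) (×-congʳ (suc n) (sym (*-assoc x (x ^ n) y)))

  ^-+-multiple-Cong : ∀ n → Cong m (n ·ℕ 1#) 0# → ∀ x y → Cong (m * m) ((x + m * y) ^ n) (x ^ n)
  ^-+-multiple-Cong zero    n·1≡0 x y = Cong-refl
  ^-+-multiple-Cong {m} (suc n) n·1≡0 x y = begin
    (x + m * y) ^ suc n                        ≈⟨ ^-+-multiple n m x y ⟩
    x ^ suc n + m * (suc n ·ℕ (x ^ n * y))     ≈⟨ Cong-+ Cong-refl (Cong-scale m (×1-Cong0 (suc n) n·1≡0 (x ^ n * y))) ⟩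
    x ^ suc n + m * 0#                         ≈⟨ ≈⇒Cong (trans (+-cong refl (zeroʳ m)) (+-identityʳ _)) ⟩
    x ^ suc n                                  ∎
    where open CongReasoning (m * m)

  sumFrom1-Cong0 : ∀ f N → (∀ t → t < N → Cong m (f (suc t)) 0#) → Cong m (sumFrom1 f N) 0#
  sumFrom1-Cong0 f zero    terms≡0 = Cong-refl
  sumFrom1-Cong0 f (suc N) terms≡0 =
    Cong0-+ (sumFrom1-Cong0 f N (λ t t<N → terms≡0 t (ℕ.m<n⇒m<1+n t<N))) (terms≡0 N ℕ.≤-refl)

  Cps-multiple : ∀ p s x m w → Cong m (Cps p s x (m * w)) 0#
  Cps-multiple p s x m w = Cong-trans (Cong-neg (binomialTail (p ^ℕ s))) (≈⇒Cong ε⁻¹≈ε)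
    where
    -- N stands for p^s, kept variable so that N ∸ 1 and N ∸ t compute once N is split.
    binomialTail : ∀ N → Cong m (sumFrom1 (λ t → divBy p (N C t) ·ℕ (x ^ t * (m * w) ^ (N ∸ t))) (N ∸ 1)) 0#
    binomialTail zero    = Cong-refl
    binomialTail (suc N) = sumFrom1-Cong0 _ N λ t t<N →
      Cong0-× (divBy p (suc N C suc t)) (Cong0-*ˡ (x ^ suc t) (Cong0-^ (ℕ.m<n⇒0<n∸m t<N) (multiple-Cong0 w)))

module FrobeniusLift {c ℓ} (R : CommutativeRing c ℓ) where
  open CommutativeRing R
  open RingOps R
  open Congruence R
  open Perturbation R
  open CommutativeSemiringExpProperties commutativeSemiring using (^-distrib-*)
  open NaturalSolver commutativeSemiring using (solve; _:=_; _:+_; _:*_)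

  frob-Cong²⇒Cong : ∀ {ϖ} → (∀ x → ϖ * x ≈ 0# → x ≈ 0#) → ∀ p s {d₁ d₂} →
                    (∀ r → Cong (ϖ * ϖ) (frob p s ϖ d₁ r) (frob p s ϖ d₂ r)) → ∀ r → Cong ϖ (d₁ r) (d₂ r)
  frob-Cong²⇒Cong torsionFree p s frobs≡ r = Cong-*-cancelˡ torsionFree (Cong-+-cancelˡ (r ^ (p ^ℕ s)) (frobs≡ r))

  module _ {p s : ℕ} {ϖ ν : Carrier} {δ : Carrier → Carrier} (isδ : IsHigherDeriv p s ϖ ν δ) where
    open IsHigherDeriv isδ

    private
      q : ℕ
      q = p ^ℕ s

      φ : Carrier → Carrier
      φ = frob p s ϖ δ

    φ-* : ∀ x y → φ (x * y) ≈ φ x * φ y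
    φ-* x y = begin
      (x * y) ^ q + ϖ * δ (x * y)
        ≈⟨ +-cong (^-distrib-* x y q) (*-cong refl (δ-mul x y)) ⟩
      x ^ q * y ^ q + ϖ * ((x ^ q * δ y + y ^ q * δ x) + ϖ * δ x * δ y)
        ≈⟨ solve 5 (λ X Y Dx Dy w → X :* Y :+ w :* ((X :* Dy :+ Y :* Dx) :+ w :* Dx :* Dy)
                      := (X :+ w :* Dx) :* (Y :+ w :* Dy)) refl (x ^ q) (y ^ q) (δ x) (δ y) ϖ ⟩
      (x ^ q + ϖ * δ x) * (y ^ q + ϖ * δ y) ∎
      where open SetoidReasoning setoid

    φ-1# : φ 1# ≈ 1#
    φ-1# = trans (+-cong (1#^ q) (trans (*-cong refl δ-one) (zeroʳ ϖ))) (+-identityʳ 1#)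
      where
      1#^ : ∀ n → 1# ^ n ≈ 1#
      1#^ zero    = refl
      1#^ (suc n) = trans (*-identityˡ (1# ^ n)) (1#^ n)

    φ-^ : ∀ x n → φ (x ^ n) ≈ φ x ^ n
    φ-^ x zero    = φ-1#
    φ-^ x (suc n) = trans (φ-* x (x ^ n)) (*-cong refl (φ-^ x n))

    ϖ*δ[^q]-Cong0 : Cong ϖ (q ·ℕ 1#) 0# → ∀ a → Cong (ϖ * ϖ) (ϖ * δ (a ^ q)) 0#
    ϖ*δ[^q]-Cong0 q·1≡0 a = Cong-+-cancelˡ ((a ^ q) ^ q) (begin
      (a ^ q) ^ q + ϖ * δ (a ^ q)   ≈⟨ ≈⇒Cong (φ-^ a q) ⟩
      (a ^ q + ϖ * δ a) ^ q          ≈⟨ ^-+-multiple-Cong q q·1≡0 (a ^ q) (δ a) ⟩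
      (a ^ q) ^ q                    ≈⟨ ≈⇒Cong (+-identityʳ _) ⟨
      (a ^ q) ^ q + 0#               ∎)
      where open CongReasoning (ϖ * ϖ)

    δ-ϖ* : 1 ≤ q → ∀ w → Cong ϖ (δ (ϖ * w)) (δ ϖ * w ^ q)
    δ-ϖ* 1≤q w = begin
      δ (ϖ * w)                                        ≈⟨ ≈⇒Cong (δ-mul ϖ w) ⟩
      (ϖ ^ q * δ w + w ^ q * δ ϖ) + ϖ * δ ϖ * δ w      ≈⟨ Cong-+ (Cong-+ ϖ^q*δw≡0 Cong-refl) (Cong0-*ʳ (δ w) (multiple-Cong0 (δ ϖ))) ⟩
      (0# + w ^ q * δ ϖ) + 0#                          ≈⟨ ≈⇒Cong (trans (+-identityʳ _) (trans (+-identityˡ _) (*-comm _ _))) ⟩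
      δ ϖ * w ^ q                                      ∎
      where
      open CongReasoning ϖ
      ϖ^q*δw≡0 : Cong ϖ (ϖ ^ q * δ w) 0#
      ϖ^q*δw≡0 = Cong0-*ʳ (δ w) (Cong0-^ 1≤q modulus-Cong0)

    δ-+ϖ* : 1 ≤ q → ∀ x w → Cong ϖ (δ (x + ϖ * w)) (δ x + δ ϖ * w ^ q)
    δ-+ϖ* 1≤q x w = begin
      δ (x + ϖ * w)                              ≈⟨ ≈⇒Cong (δ-add x (ϖ * w)) ⟩
      (δ x + δ (ϖ * w)) + ν * Cps p s x (ϖ * w)  ≈⟨ Cong-+ (Cong-+ Cong-refl (δ-ϖ* 1≤q w)) (Cong0-*ˡ ν (Cps-multiple p s x ϖ w)) ⟩
      (δ x + δ ϖ * w ^ q) + 0#                   ≈⟨ ≈⇒Cong (+-identityʳ _) ⟩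
      δ x + δ ϖ * w ^ q                          ∎
      where open CongReasoning ϖ

    φ-^q+ϖ* : Cong ϖ (q ·ℕ 1#) 0# → 1 ≤ q → ∀ a w →
              Cong (ϖ * ϖ) (φ (a ^ q + ϖ * w)) ((a ^ q) ^ q + ϖ * (δ ϖ * w ^ q))
    φ-^q+ϖ* q·1≡0 1≤q a w = begin
      (a ^ q + ϖ * w) ^ q + ϖ * δ (a ^ q + ϖ * w)
        ≈⟨ Cong-+ (^-+-multiple-Cong q q·1≡0 (a ^ q) w) (Cong-scale ϖ (δ-+ϖ* 1≤q (a ^ q) w)) ⟩
      (a ^ q) ^ q + ϖ * (δ (a ^ q) + T)
        ≈⟨ ≈⇒Cong (solve 4 (λ X w D T → X :+ w :* (D :+ T) := (X :+ w :* D) :+ w :* T) refl ((a ^ q) ^ q) ϖ (δ (a ^ q)) T) ⟩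
      ((a ^ q) ^ q + ϖ * δ (a ^ q)) + ϖ * T
        ≈⟨ Cong-+ (Cong-+ Cong-refl (ϖ*δ[^q]-Cong0 q·1≡0 a)) Cong-refl ⟩
      ((a ^ q) ^ q + 0#) + ϖ * T
        ≈⟨ ≈⇒Cong (+-cong (+-identityʳ _) refl) ⟩
      (a ^ q) ^ q + ϖ * T ∎
      where
      open CongReasoning (ϖ * ϖ)
      T = δ ϖ * w ^ q

module _ {c ℓ p} (B : PiBase p c ℓ) where
  open PiBase B

  π-torsionFree : ∀ x → π * x ≈ 0# → x ≈ 0#
  π-torsionFree x πx≈0 with domain π x πx≈0
  ... | inj₁ π≈0 = contradiction π≈0 π≉0
  ... | inj₂ x≈0 = x≈0

module Commutation {c ℓ c' ℓ' p s' n} .{{_ : ℕ.NonZero p}} {B : PiBase p c ℓ} {δR}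
                   (D : PartialDeltaRing (suc s') n B δR c' ℓ')
                   (flat : PartialDeltaRing.Flat D) where
  open PartialDeltaRing D
  open Congruence A
  open Perturbation A
  open FrobeniusLift A using (φ-^q+ϖ*)
  open RingProperties ring using (x[y-z]≈xy-xz)
  open IsRingHomomorphism ι-hom
  open MonoidMultProperties +-monoid using (×-congʳ; ×-assocˡ)
  open SemiringExpProperties semiring using (^-congʳ; ^-assocʳ)

  s q : ℕ
  s = suc s'
  q = p ^ℕ s

  ϖ : Carrier
  ϖ = ι R.π

  ι-× : ∀ k r → ι (k R.·ℕ r) ≈ k ·ℕ ι r
  ι-× zero    r = 0#-homo
  ι-× (suc k) r = trans (+-homo r (k R.·ℕ r)) (+-cong refl (ι-× k r))

  p·1≡0 : Cong ϖ (p ·ℕ 1#) 0#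
  p·1≡0 = Cong-trans (≈⇒Cong (begin
    p ·ℕ 1#               ≈⟨ ×-congʳ p 1#-homo ⟨
    p ·ℕ ι R.1#           ≈⟨ ι-× p R.1# ⟨
    ι (p R.·ℕ R.1#)       ≈⟨ ⟦⟧-cong R.π*p/π≈p ⟨
    ι (R.π R.* R.p/π)     ≈⟨ *-homo R.π R.p/π ⟩
    ϖ * ι R.p/π           ∎)) (multiple-Cong0 (ι R.p/π))
    where open SetoidReasoning setoid

  q·1≡0 : Cong ϖ (q ·ℕ 1#) 0#
  q·1≡0 = Cong-trans (≈⇒Cong (sym (×-assocˡ 1# p (p ^ℕ s')))) (×1-Cong0 p p·1≡0 ((p ^ℕ s') ·ℕ 1#))

  1≤q : 1 ≤ q
  1≤q = ℕ.m^n>0 p s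

  ^-[p^[s+s]]≈[^q]^q : ∀ a → a ^ (p ^ℕ (s ℕ.+ s)) ≈ (a ^ q) ^ q
  ^-[p^[s+s]]≈[^q]^q a = trans (^-congʳ a (ℕ.^-distribˡ-+-* p s s)) (sym (^-assocʳ a q q))

  φφ-expansion : ∀ i j a → Cong (ϖ * ϖ) (φ i (φ j a)) (a ^ (p ^ℕ (s ℕ.+ s)) + ϖ * (δ i ϖ * δ j a ^ q))
  φφ-expansion i j a =
    Cong-trans (φ-^q+ϖ* (δ-der i) q·1≡0 1≤q a (δ j a)) (≈⇒Cong (+-cong (sym (^-[p^[s+s]]≈[^q]^q a)) refl))

  φφ-Cong : ∀ i j a → Cong ϖ (φ i (φ j a)) (a ^ (p ^ℕ (s ℕ.+ s)))
  φφ-Cong i j a = Cong-trans (Cong-weaken ϖ (φφ-expansion i j a))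
                             (Cong-trans (Cong-+ Cong-refl (multiple-Cong0 _)) (≈⇒Cong (+-identityʳ _)))

  commutator-Cong0 : ∀ i j a → Cong ϖ (φ i (φ j a) - φ j (φ i a)) 0#
  commutator-Cong0 i j a =
    Cong-trans (Cong-+ (φφ-Cong i j a) (Cong-neg (φφ-Cong j i a))) (≈⇒Cong (-‿inverseʳ _))

  δ²-exists : ∀ i j a → ∃ λ d → IsDelta2 i j a d
  δ²-exists i j a = let d , φφ-X≈ϖd = φφ-Cong i j a in d , sym φφ-X≈ϖd

  δ²-Cong : ∀ i j a d → IsDelta2 i j a d → Cong ϖ d (δ i ϖ * δ j a ^ q)
  δ²-Cong i j a d ϖd≈φφ-X = Cong-*-cancelˡ flat (Cong-+-cancelˡ (a ^ (p ^ℕ (s ℕ.+ s)))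
    (Cong-trans (≈⇒Cong (sym (x-y≈w⇒x≈y+w (sym ϖd≈φφ-X)))) (φφ-expansion i j a)))

  commutator/ϖ-Cong : ∀ i j a e → ϖ * e ≈ φ i (φ j a) - φ j (φ i a) →
                      Cong ϖ e (δ i ϖ * δ j a ^ q - δ j ϖ * δ i a ^ q)
  commutator/ϖ-Cong i j a e ϖe≈ = Cong-*-cancelˡ flat (begin
    ϖ * e                          ≈⟨ ≈⇒Cong ϖe≈ ⟩
    φ i (φ j a) - φ j (φ i a)      ≈⟨ Cong-+ (φφ-expansion i j a) (Cong-neg (φφ-expansion j i a)) ⟩
    (X + ϖ * Tᵢ) - (X + ϖ * Tⱼ)    ≈⟨ ≈⇒Cong (trans ([x+y]-[x+z]≈y-z X (ϖ * Tᵢ) (ϖ * Tⱼ)) (sym (x[y-z]≈xy-xz ϖ Tᵢ Tⱼ))) ⟩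
    ϖ * (Tᵢ - Tⱼ)                  ∎)
    where
    open CongReasoning (ϖ * ϖ)
    X  = a ^ (p ^ℕ (s ℕ.+ s))
    Tᵢ = δ i ϖ * δ j a ^ q
    Tⱼ = δ j ϖ * δ i a ^ q

  δ²-commutator-Cong : ∀ i j a dᵢⱼ dⱼᵢ → IsDelta2 i j a dᵢⱼ → IsDelta2 j i a dⱼᵢ →
                       Cong ϖ (δ i ϖ * δ j a ^ q - δ j ϖ * δ i a ^ q) (dᵢⱼ - dⱼᵢ)
  δ²-commutator-Cong i j a dᵢⱼ dⱼᵢ isδ²ᵢⱼ isδ²ⱼᵢ =
    Cong-sym (Cong-+ (δ²-Cong i j a dᵢⱼ isδ²ᵢⱼ) (Cong-neg (δ²-Cong j i a dⱼᵢ isδ²ⱼᵢ)))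

lemma2p16 : ∀ {c ℓ c' ℓ' : Level} (p s n : ℕ) → Prime p → p ≢ 2 → 1 ≤ s → 1 ≤ n →
  (B : PiBase p c ℓ) →
  (δR : Fin n → PiBase.Carrier B → PiBase.Carrier B) →
  (∀ i → PiBase.IsHigherDeriv B p s (PiBase.π B) (PiBase.p/π B) (δR i)) →
  (D : PartialDeltaRing s n B δR c' ℓ') →
  PartialDeltaRing.Flat D →
  let open PartialDeltaRing D
      ϖ = ι R.π
      q = p ^ℕ s
  in ∀ (i j : Fin n) →
     (∀ (a : Carrier) →
        Cong ϖ (φ i (φ j a) - φ j (φ i a)) 0#
        × ((∃ λ d → IsDelta2 i j a d)
           × (∀ d → IsDelta2 i j a d → Cong ϖ d (δ i ϖ * δ j a ^ q)))
        × (∀ e → ϖ * e ≈ φ i (φ j a) - φ j (φ i a) →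
             Cong ϖ e (δ i ϖ * δ j a ^ q - δ j ϖ * δ i a ^ q)
             × (∀ dij dji → IsDelta2 i j a dij → IsDelta2 j i a dji →
                 Cong ϖ (δ i ϖ * δ j a ^ q - δ j ϖ * δ i a ^ q) (dij - dji))))
     × ((∀ (r : R.Carrier) →
           R.Cong (R.π R.* R.π)
             (R.frob p s R.π (δR i) r) (R.frob p s R.π (δR j) r)) →
        ∀ (r : R.Carrier) → R.Cong R.π (δR i r) (δR j r))
lemma2p16 p (suc s') n p-prime _ _ _ B δR _ D flat i j =
    (λ a → commutator-Cong0 i j a
         , (δ²-exists i j a , δ²-Cong i j a)
         , λ e ϖe≈ → commutator/ϖ-Cong i j a e ϖe≈ , δ²-commutator-Cong i j a)
  , FrobeniusLift.frob-Cong²⇒Cong (PiBase.Rπ B) (π-torsionFree B) p (suc s') {δR i} {δR j}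
  where open Commutation {{prime⇒nonZero p-prime}} D flat
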